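{- If $G_\tau$ is a connected bidirected graph, then every transitive reduction $\mathrm{Rt}(G_\tau)$ of $G_\tau$ is connected.
   Context: A graph $G=(V,E)$ is finite, with loops and multiple edges allowed. A half-edge is a pair $(e,x)$ with $e$ incident with $x$ (a loop has two half-edges at its vertex). A bidirected graph $G_\tau=(V,E;\tau)$ is a graph with a map $\tau$ assigning $+1$ or $-1$ to every half-edge; an edge with ends $x,y$ and $\tau(e,x)=\alpha,\tau(e,y)=\beta$ is written $\{x^\alpha,y^\beta\}$. A partial graph of $G_\tau$ is $(V,F;\tau|_F)$ with $F\subseteq E$. A chain is $x_0,e_1,x_1,\ldots,e_k,x_k$ where $e_i$ has ends $x_{i-1},x_i$; when $e_i$ is traversed from $x_{i-1}$ to $x_i$, $\tau(e_i,x_{i-1}),\tau(e_i,x_i)$ denote the values at the corresponding half-edges. For $\alpha,\beta\in\{\pm1\}$ a b-walk from $x^\alpha$ to $y^\beta$ is a chain $x=x_0,e_1,\ldots,e_k,x_k=y$ with $k\ge1$, $\tau(e_1,x_0)=\alpha$, $\tau(e_k,x_k)=\beta$ and $\tau(e_i,x_i)+\tau(e_{i+1},x_i)=0$ for $1\le i\le k-1$. A b-path from $x^\alpha$ to $y^\beta$ is a b-walk from $x^\alpha$ to $y^\beta$ minimal with these properties (no b-walk from $x^\alpha$ to $y^\beta$ has as edge sequence a proper subsequence, in the same order, of its edge sequence); $x=y$ allowed. For a partial graph $H_\tau$ of $G_\tau$, $\mathrm{ft}(G_\tau;H_\tau)$ is the partial graph of $G_\tau$ whose edges are the edges of $G_\tau$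 that are edges of $H_\tau$ or are of the form $\{x^\alpha,y^\beta\}$ with a b-path from $x^\alpha$ to $y^\beta$ in $H_\tau$. A transitive reduction $\mathrm{Rt}(G_\tau)$ of $G_\tau$ is a minimal partial graph $R$ of $G_\tau$ with $\mathrm{ft}(G_\tau;R)=G_\tau$. -}

module Defs where

open import Data.Nat using (ℕ)
open import Data.Fin using (Fin)
open import Data.Fin.Subset using (Subset; _∈_; _⊆_; ⊤)
open import Data.Bool using (Bool; true; false)
open import Data.Sign using (Sign; opposite)
open import Data.List using (List; []; _∷_; [_]; map)
open import Data.List.Relation.Unary.All using (All)
open import Data.List.Relation.Binary.Sublist.Propositional as SL using ()
open import Data.Product using (Σ; _×_; _,_; Σ-syntax)
open import Data.Sum using (_⊎_)
open import Relation.Binary.PropositionalEquality using (_≡_)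
open import Relation.Binary.Construct.Closure.ReflexiveTransitive using (Star)

-- A finite bidirected graph: vertices Fin n, edges Fin m.
-- Edge e has two half-edges (e,end₁ e) with sign sign₁ e and (e,end₂ e) with
-- sign sign₂ e.  Loops (end₁ e ≡ end₂ e) and multiple edges are allowed;
-- +1 / -1 are represented by Data.Sign's + / -.
record Bigraph : Set where
  field
    n m   : ℕ
    end₁  : Fin m → Fin n
    end₂  : Fin m → Fin n
    sign₁ : Fin m → Sign
    sign₂ : Fin m → Sign

module _ (G : Bigraph) where
  open Bigraph G

  -- A partial graph (V,F;τ|F) is given by its edge set F.
  PartialGraph : Set
  PartialGraph = Subset m

  -- A traversal step: an edge with a direction
  -- (true = from end₁ to end₂, false = from end₂ to end₁).
  Step : Set
  Step = Σ (Fin m) (λ _ → Bool)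

  edge : Step → Fin m
  edge (e , _) = e

  tailV headV : Step → Fin n
  tailV (e , true)  = end₁ e
  tailV (e , false) = end₂ e
  headV (e , true)  = end₂ e
  headV (e , false) = end₁ e

  tailS headS : Step → Sign
  tailS (e , true)  = sign₁ e
  tailS (e , false) = sign₂ e
  headS (e , true)  = sign₂ e
  headS (e , false) = sign₁ e

  -- b-walk from x^α to y^β in G (k ≥ 1 steps); consecutive condition
  -- τ(e_i,x_i) + τ(e_{i+1},x_i) = 0, i.e. the next tail sign is the opposite.
  data BWalk (x : Fin n) (α : Sign) (y : Fin n) (β : Sign) : List Step → Set where
    single : ∀ s → tailV s ≡ x → tailS s ≡ α → headV s ≡ y → headS s ≡ β →
             BWalk x α y β [ s ]
    cons   : ∀ s ws → tailV s ≡ x → tailS s ≡ α →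
             BWalk (headV s) (opposite (headS s)) y β ws →
             BWalk x α y β (s ∷ ws)

  edgeSeq : List Step → List (Fin m)
  edgeSeq = map edge

  -- b-path: a b-walk such that no b-walk with the same ends has as edge
  -- sequence a proper subsequence (same order) of its edge sequence.
  BPath : Fin n → Sign → Fin n → Sign → List Step → Set
  BPath x α y β ws =
    BWalk x α y β ws ×
    (∀ ws′ → BWalk x α y β ws′ →
       edgeSeq ws′ SL.⊆ edgeSeq ws → edgeSeq ws′ ≡ edgeSeq ws)

  BPathIn : PartialGraph → Fin n → Sign → Fin n → Sign → List Step → Set
  BPathIn H x α y β ws = BPath x α y β ws × All (λ s → edge s ∈ H) ws

  -- e is an edge of ft(G;H): e ∈ H, or e = {x^α,y^β} with a b-path from
  -- x^α to y^β in H (either way of writing the unordered edge).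
  InFt : PartialGraph → Fin m → Set
  InFt H e =
    e ∈ H ⊎
    (Σ[ ws ∈ List Step ] BPathIn H (end₁ e) (sign₁ e) (end₂ e) (sign₂ e) ws) ⊎
    (Σ[ ws ∈ List Step ] BPathIn H (end₂ e) (sign₂ e) (end₁ e) (sign₁ e) ws)

  FtIsG : PartialGraph → Set
  FtIsG H = ∀ e → InFt H e

  IsTransitiveReduction : PartialGraph → Set
  IsTransitiveReduction R =
    FtIsG R × (∀ R′ → R′ ⊆ R → FtIsG R′ → R′ ≡ R)

  -- Connectivity of a partial graph (on the full vertex set V),
  -- ignoring signs: any two vertices are joined by a chain of edges of F.
  Adj : PartialGraph → Fin n → Fin n → Set
  Adj F x y = Σ[ e ∈ Fin m ] (e ∈ F ×
                ((end₁ e ≡ x × end₂ e ≡ y) ⊎ (end₁ e ≡ y × end₂ e ≡ x)))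

  ConnectedPartial : PartialGraph → Set
  ConnectedPartial F = ∀ x y → Star (Adj F) x y

  Connected : Set
  Connected = ConnectedPartial ⊤

module Submission where

-- Connectivity ignores signs, so it suffices to see that every
-- edge of G is "simulated" by a chain of edges of R.  If R is a transitive
-- reduction then ft(G;R) = G, so each edge e = {x^α,y^β} of G either lies in
-- R or is shortcut by a b-path of R between its ends; a b-path is in
-- particular a b-walk, whose steps join x to y inside R.  Replacing every
-- edge of a chain of G by such an R-chain turns any chain of G into a chain
-- of R.

open import Defs
open import Data.Bool using (true; false)
open import Data.Fin using (Fin)
open import Data.Fin.Subset using (_∈_; ⊤)
open import Data.Product using (_,_; proj₁)
open import Data.Sum using (inj₁; inj₂)
open import Data.List.Relation.Unary.All using (All; []; _∷_)
open import Relation.Binary.PropositionalEquality using (refl)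
open import Relation.Binary.Construct.Closure.ReflexiveTransitive
  using (Star; ε; _◅_; reverse; _⋆)

module _ (G : Bigraph) where
  open Bigraph G

  Chain : PartialGraph G → Fin n → Fin n → Set
  Chain H = Star (Adj G H)

  adj-sym : ∀ {H x y} → Adj G H x y → Adj G H y x
  adj-sym (e , e∈H , inj₁ ends) = e , e∈H , inj₂ ends
  adj-sym (e , e∈H , inj₂ ends) = e , e∈H , inj₁ ends

  chain-reverse : ∀ {H x y} → Chain H x y → Chain H y x
  chain-reverse = reverse adj-sym

  step-adj : ∀ {H} s → edge G s ∈ H → Adj G H (tailV G s) (headV G s)
  step-adj (e , true)  e∈H = e , e∈H , inj₁ (refl , refl)
  step-adj (e , false) e∈H = e , e∈H , inj₂ (refl , refl)

  bwalk-chain : ∀ {H x α y β ws} → BWalk G x α y β ws →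
                All (λ s → edge G s ∈ H) ws → Chain H x y
  bwalk-chain (single s refl _ refl _) (s∈H ∷ []) = step-adj s s∈H ◅ ε
  bwalk-chain (cons s _ refl _ walk) (s∈H ∷ rest) =
    step-adj s s∈H ◅ bwalk-chain walk rest

  ft-edge-chain : ∀ {H} e → InFt G H e → Chain H (end₁ e) (end₂ e)
  ft-edge-chain e (inj₁ e∈H) = (e , e∈H , inj₁ (refl , refl)) ◅ ε
  ft-edge-chain e (inj₂ (inj₁ (_ , (walk , _) , inH))) = bwalk-chain walk inH
  ft-edge-chain e (inj₂ (inj₂ (_ , (walk , _) , inH))) =
    chain-reverse (bwalk-chain walk inH)

  ft-adj-chain : ∀ {H} → FtIsG G H → ∀ {x y} → Adj G ⊤ x y → Chain H x y
  ft-adj-chain ft (e , _ , inj₁ (refl , refl)) = ft-edge-chain e (ft e)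
  ft-adj-chain ft (e , _ , inj₂ (refl , refl)) =
    chain-reverse (ft-edge-chain e (ft e))

  ft-connected : ∀ {H} → Connected G → FtIsG G H → ConnectedPartial G H
  ft-connected connected ft x y = (ft-adj-chain ft ⋆) (connected x y)

proposition37 : (G : Bigraph) → Connected G →
    (R : PartialGraph G) → IsTransitiveReduction G R → ConnectedPartial G R
proposition37 G connected R reduction = ft-connected G connected (proj₁ reduction)
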